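{- Every Kleene monad $(T,\mu,\eta)$ on a category $\mathsf{C}$ is an ordered saturation monad (with respect to the order on hom-sets of $\mathcal{K}l(T)$ induced by the join-semilattice structure) which moreover satisfies, for all $\alpha:X\rightsquigarrow X$, all $f:X\rightsquigarrow Y$ in $\mathcal{K}l(T)$ and all $\beta:Y\rightsquigarrow Y$: $f\cdot\alpha\le\beta\cdot f$ implies $f\cdot\alpha^*\le\beta^*\cdot f$, and $f\cdot\alpha\ge\beta\cdot f$ implies $f\cdot\alpha^*\ge\beta^*\cdot f$.
   Context: Kleisli category $\mathcal{K}l(T)$: morphisms $X\rightsquigarrow Y$ are morphisms $X\to TY$, composition $g\cdot f=\mu_Z\circ Tg\circ f$, identity $1_X=\eta_X$; $f^\sharp=\eta_Y\circ f$. A monad is additive if every hom-set of $\mathcal{K}l(T)$ is a join-semilattice $(\vee)$ with least element $\bot$ such that $(f\vee g)\cdot h=f\cdot h\vee g\cdot h$, $h\cdot(f\vee g)=h\cdot f\vee h\cdot g$ and $f\cdot\bot=\bot\cdot f=\bot$. It is a Kleene monad if additionally, for all composable $p,r$, the maps $f\mapsto p\vee f\cdot r$ and $f\mapsto p\vee r\cdot f$ have least fixed points (denoted $\mu x.(\dots)$), and for all suitable $q$: $\mu x.(p\cdot q\vee x\cdot r)=p\cdot\mu x.(q\vee x\cdot r)$ and $\mu x.(p\cdot q\vee r\cdot x)=\mu x.(p\vee r\cdot x)\cdot q$. Order: $f\le g$ iff $f\vee g=g$. Ordered saturation monad: $\mathcal{K}l(T)$ order enriched (hom-sets posets, composition monotone)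 and for each $\alpha:X\rightsquigarrow X$ there is $\alpha^*$ with (1) $1\le\alpha^*$; (2) $\alpha\le\alpha^*$; (3) $\alpha^*\cdot\alpha^*\le\alpha^*$; (4) $\alpha^*\le\beta$ whenever $1\le\beta$, $\alpha\le\beta$, $\beta\cdot\beta\le\beta$; (5) for $f:X\to Y$ in $\mathsf{C}$ and $\beta:Y\rightsquigarrow Y$, $f^\sharp\cdot\alpha\le\beta\cdot f^\sharp\Rightarrow f^\sharp\cdot\alpha^*\le\beta^*\cdot f^\sharp$, and likewise with $\ge$. -}

module Defs where

open import Level using (Level; _⊔_; suc)
open import Relation.Binary.PropositionalEquality using (_≡_)
open import Relation.Binary.Structures using (IsPartialOrder)
open import Data.Product using (Σ; _×_)

record Category (o ℓ : Level) : Set (suc (o ⊔ ℓ)) where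
  infixr 9 _∘_
  field
    Obj  : Set o
    Hom  : Obj → Obj → Set ℓ
    id   : ∀ {X} → Hom X X
    _∘_  : ∀ {X Y Z} → Hom Y Z → Hom X Y → Hom X Z
    identityˡ : ∀ {X Y} (f : Hom X Y) → id ∘ f ≡ f
    identityʳ : ∀ {X Y} (f : Hom X Y) → f ∘ id ≡ f
    assoc : ∀ {W X Y Z} (h : Hom Y Z) (g : Hom X Y) (f : Hom W X) →
            (h ∘ g) ∘ f ≡ h ∘ (g ∘ f)

record Monad {o ℓ : Level} (C : Category o ℓ) : Set (o ⊔ ℓ) where
  open Category C
  field
    T     : Obj → Obj
    fmap  : ∀ {X Y} → Hom X Y → Hom (T X) (T Y)
    fmap-id : ∀ {X} → fmap (id {X}) ≡ id
    fmap-∘  : ∀ {X Y Z} (g : Hom Y Z) (f : Hom X Y) → fmap (g ∘ f) ≡ fmap g ∘ fmap f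
    η     : ∀ X → Hom X (T X)
    μ     : ∀ X → Hom (T (T X)) (T X)
    η-natural : ∀ {X Y} (f : Hom X Y) → η Y ∘ f ≡ fmap f ∘ η X
    μ-natural : ∀ {X Y} (f : Hom X Y) → μ Y ∘ fmap (fmap f) ≡ fmap f ∘ μ X
    unitˡ : ∀ X → μ X ∘ fmap (η X) ≡ id
    unitʳ : ∀ X → μ X ∘ η (T X) ≡ id
    mult-assoc : ∀ X → μ X ∘ fmap (μ X) ≡ μ X ∘ μ (T X)

module Kleisli {o ℓ : Level} {C : Category o ℓ} (M : Monad C) where
  open Category C
  open Monad M

  _⇝_ : Obj → Obj → Set ℓ
  X ⇝ Y = Hom X (T Y)

  infixr 9 _·_
  _·_ : ∀ {X Y Z} → Y ⇝ Z → X ⇝ Y → X ⇝ Z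
  _·_ {Z = Z} g f = μ Z ∘ (fmap g ∘ f)

  𝟙 : ∀ {X} → X ⇝ X
  𝟙 {X} = η X

  _♯ : ∀ {X Y} → Hom X Y → X ⇝ Y
  _♯ {Y = Y} f = η Y ∘ f

record Additive {o ℓ : Level} {C : Category o ℓ} (M : Monad C) : Set (o ⊔ ℓ) where
  open Category C
  open Kleisli M
  infixr 6 _∨_
  field
    _∨_ : ∀ {X Y} → X ⇝ Y → X ⇝ Y → X ⇝ Y
    ⊥   : ∀ {X Y} → X ⇝ Y
    ∨-assoc : ∀ {X Y} (f g h : X ⇝ Y) → (f ∨ g) ∨ h ≡ f ∨ (g ∨ h)
    ∨-comm  : ∀ {X Y} (f g : X ⇝ Y) → f ∨ g ≡ g ∨ f
    ∨-idem  : ∀ {X Y} (f : X ⇝ Y) → f ∨ f ≡ f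
    ⊥-least : ∀ {X Y} (f : X ⇝ Y) → ⊥ ∨ f ≡ f
    ·-distribʳ : ∀ {X Y Z} (f g : Y ⇝ Z) (h : X ⇝ Y) → (f ∨ g) · h ≡ (f · h) ∨ (g · h)
    ·-distribˡ : ∀ {X Y Z} (h : Y ⇝ Z) (f g : X ⇝ Y) → h · (f ∨ g) ≡ (h · f) ∨ (h · g)
    ·-⊥ʳ : ∀ {X Y Z} (f : Y ⇝ Z) → f · (⊥ {X} {Y}) ≡ ⊥
    ·-⊥ˡ : ∀ {X Y Z} (f : X ⇝ Y) → (⊥ {Y} {Z}) · f ≡ ⊥

  infix 4 _≤_
  _≤_ : ∀ {X Y} → X ⇝ Y → X ⇝ Y → Set ℓ
  f ≤ g = f ∨ g ≡ g

record Kleene {o ℓ : Level} {C : Category o ℓ} (M : Monad C) : Set (o ⊔ ℓ) where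
  open Category C
  open Kleisli M
  field
    additive : Additive M
  open Additive additive
  field
    lfpʳ : ∀ {X Y} (p : X ⇝ Y) (r : X ⇝ X) → X ⇝ Y
    lfpʳ-fix : ∀ {X Y} (p : X ⇝ Y) (r : X ⇝ X) → lfpʳ p r ≡ p ∨ lfpʳ p r · r
    lfpʳ-least : ∀ {X Y} (p : X ⇝ Y) (r : X ⇝ X) (f : X ⇝ Y) →
                 f ≡ p ∨ f · r → lfpʳ p r ≤ f
    lfpˡ : ∀ {X Y} (p : X ⇝ Y) (r : Y ⇝ Y) → X ⇝ Y
    lfpˡ-fix : ∀ {X Y} (p : X ⇝ Y) (r : Y ⇝ Y) → lfpˡ p r ≡ p ∨ r · lfpˡ p r
    lfpˡ-least : ∀ {X Y} (p : X ⇝ Y) (r : Y ⇝ Y) (f : X ⇝ Y) →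
                 f ≡ p ∨ r · f → lfpˡ p r ≤ f
    lfpʳ-law : ∀ {X Y Z} (p : Y ⇝ Z) (q : X ⇝ Y) (r : X ⇝ X) →
               lfpʳ (p · q) r ≡ p · lfpʳ q r
    lfpˡ-law : ∀ {X Y Z} (p : Y ⇝ Z) (q : X ⇝ Y) (r : Z ⇝ Z) →
               lfpˡ (p · q) r ≡ lfpˡ p r · q

record OrderedSaturation {o ℓ ℓ′ : Level} {C : Category o ℓ} (M : Monad C)
       (_≤_ : ∀ {X Y} → Kleisli._⇝_ M X Y → Kleisli._⇝_ M X Y → Set ℓ′)
       : Set (o ⊔ ℓ ⊔ ℓ′) where
  open Category C
  open Kleisli M
  field
    isPartialOrder : ∀ {X Y} → IsPartialOrder (_≡_ {A = X ⇝ Y}) _≤_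
    ·-mono : ∀ {X Y Z} {f f′ : Y ⇝ Z} {g g′ : X ⇝ Y} →
             f ≤ f′ → g ≤ g′ → (f · g) ≤ (f′ · g′)
    _* : ∀ {X} → X ⇝ X → X ⇝ X
    *-refl  : ∀ {X} (α : X ⇝ X) → 𝟙 ≤ (α *)
    *-incl  : ∀ {X} (α : X ⇝ X) → α ≤ (α *)
    *-trans : ∀ {X} (α : X ⇝ X) → ((α *) · (α *)) ≤ (α *)
    *-least : ∀ {X} (α β : X ⇝ X) → 𝟙 ≤ β → α ≤ β → (β · β) ≤ β → (α *) ≤ β
    *-sim≤ : ∀ {X Y} (f : Hom X Y) (α : X ⇝ X) (β : Y ⇝ Y) →
             ((f ♯) · α) ≤ (β · (f ♯)) → ((f ♯) · (α *)) ≤ ((β *) · (f ♯))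
    *-sim≥ : ∀ {X Y} (f : Hom X Y) (α : X ⇝ X) (β : Y ⇝ Y) →
             (β · (f ♯)) ≤ ((f ♯) · α) → ((β *) · (f ♯)) ≤ ((f ♯) · (α *))

Theorem5p4 : ∀ {o ℓ} (C : Category o ℓ) (M : Monad C) (K : Kleene M) → Set (o ⊔ ℓ)
Theorem5p4 C M K =
  Σ (OrderedSaturation M (Additive._≤_ (Kleene.additive K))) λ S →
    let open Category C
        open Kleisli M
        open Additive (Kleene.additive K)
        open OrderedSaturation S using (_*)
    in (∀ {X Y} (α : X ⇝ X) (f : X ⇝ Y) (β : Y ⇝ Y) →
          (f · α) ≤ (β · f) → (f · (α *)) ≤ ((β *) · f))
     × (∀ {X Y} (α : X ⇝ X) (f : X ⇝ Y) (β : Y ⇝ Y) →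
          (β · f) ≤ (f · α) → ((β *) · f) ≤ (f · (α *)))

module Submission where

open import Defs
open import Level using (Level)
open import Data.Product using (_,_)
open import Relation.Binary.PropositionalEquality
open import Relation.Binary.Bundles using (Poset)
open import Relation.Binary.Structures using (IsPartialOrder)
import Relation.Binary.Reasoning.PartialOrder as PartialOrderReasoning

-- Both least-fixed-point operators of a Kleene monad yield a star: the
-- fixed-point laws turn μx.(p ∨ x·r) into p·(μx.(1 ∨ x·r)) and dually, so
-- leastness becomes an induction rule for α* on either side.  The two stars
-- then satisfy each other's characterising properties and coincide, and
-- induction on the appropriate side gives the simulation rules for arbitrary
-- Kleisli morphisms f, not only for those of the form g♯.

module KleisliLaws {o ℓ : Level} {C : Category o ℓ} (M : Monad C) where
  open Category C
  open Monad M
  open Kleisli M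
  open ≡-Reasoning

  ·-identityˡ : ∀ {X Y} (f : X ⇝ Y) → 𝟙 · f ≡ f
  ·-identityˡ {Y = Y} f = begin
    μ Y ∘ (fmap (η Y) ∘ f)  ≡⟨ assoc (μ Y) (fmap (η Y)) f ⟨
    (μ Y ∘ fmap (η Y)) ∘ f  ≡⟨ cong (_∘ f) (unitˡ Y) ⟩
    id ∘ f                  ≡⟨ identityˡ f ⟩
    f                       ∎

  ·-identityʳ : ∀ {X Y} (f : X ⇝ Y) → f · 𝟙 ≡ f
  ·-identityʳ {X} {Y} f = begin
    μ Y ∘ (fmap f ∘ η X)    ≡⟨ cong (μ Y ∘_) (η-natural f) ⟨
    μ Y ∘ (η (T Y) ∘ f)     ≡⟨ assoc (μ Y) (η (T Y)) f ⟨
    (μ Y ∘ η (T Y)) ∘ f     ≡⟨ cong (_∘ f) (unitʳ Y) ⟩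
    id ∘ f                  ≡⟨ identityˡ f ⟩
    f                       ∎

  ·-assoc : ∀ {W X Y Z} (h : Y ⇝ Z) (g : X ⇝ Y) (f : W ⇝ X) →
            (h · g) · f ≡ h · (g · f)
  ·-assoc {Y = Y} {Z} h g f = begin
    μ Z ∘ (fmap (μ Z ∘ (fmap h ∘ g)) ∘ f)
      ≡⟨ cong (λ u → μ Z ∘ (u ∘ f)) fmap-·-expand ⟩
    μ Z ∘ ((fmap (μ Z) ∘ (fmap (fmap h) ∘ fmap g)) ∘ f)
      ≡⟨ reassocˡ ⟩
    (μ Z ∘ fmap (μ Z)) ∘ (fmap (fmap h) ∘ (fmap g ∘ f))
      ≡⟨ cong (_∘ (fmap (fmap h) ∘ (fmap g ∘ f))) (mult-assoc Z) ⟩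
    (μ Z ∘ μ (T Z)) ∘ (fmap (fmap h) ∘ (fmap g ∘ f))
      ≡⟨ reassocʳ ⟩
    μ Z ∘ ((μ (T Z) ∘ fmap (fmap h)) ∘ (fmap g ∘ f))
      ≡⟨ cong (λ u → μ Z ∘ (u ∘ (fmap g ∘ f))) (μ-natural h) ⟩
    μ Z ∘ ((fmap h ∘ μ Y) ∘ (fmap g ∘ f))
      ≡⟨ cong (μ Z ∘_) (assoc (fmap h) (μ Y) (fmap g ∘ f)) ⟩
    μ Z ∘ (fmap h ∘ (μ Y ∘ (fmap g ∘ f)))
      ∎
    where
    fmap-·-expand : fmap (μ Z ∘ (fmap h ∘ g)) ≡ fmap (μ Z) ∘ (fmap (fmap h) ∘ fmap g)
    fmap-·-expand = trans (fmap-∘ (μ Z) (fmap h ∘ g)) (cong (fmap (μ Z) ∘_) (fmap-∘ (fmap h) g))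

    reassocˡ : μ Z ∘ ((fmap (μ Z) ∘ (fmap (fmap h) ∘ fmap g)) ∘ f)
             ≡ (μ Z ∘ fmap (μ Z)) ∘ (fmap (fmap h) ∘ (fmap g ∘ f))
    reassocˡ = begin
      μ Z ∘ ((fmap (μ Z) ∘ (fmap (fmap h) ∘ fmap g)) ∘ f)
        ≡⟨ cong (μ Z ∘_) (trans (assoc _ _ _) (cong (fmap (μ Z) ∘_) (assoc _ _ _))) ⟩
      μ Z ∘ (fmap (μ Z) ∘ (fmap (fmap h) ∘ (fmap g ∘ f)))
        ≡⟨ assoc _ _ _ ⟨
      (μ Z ∘ fmap (μ Z)) ∘ (fmap (fmap h) ∘ (fmap g ∘ f))
        ∎

    reassocʳ : (μ Z ∘ μ (T Z)) ∘ (fmap (fmap h) ∘ (fmap g ∘ f))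
             ≡ μ Z ∘ ((μ (T Z) ∘ fmap (fmap h)) ∘ (fmap g ∘ f))
    reassocʳ = trans (assoc _ _ _) (cong (μ Z ∘_) (sym (assoc _ _ _)))

module JoinOrder {o ℓ : Level} {C : Category o ℓ} {M : Monad C} (A : Additive M) where
  open Category C using (Obj)
  open Kleisli M
  open Additive A

  ≤-refl : ∀ {X Y} {f : X ⇝ Y} → f ≤ f
  ≤-refl {f = f} = ∨-idem f

  ≤-reflexive : ∀ {X Y} {f g : X ⇝ Y} → f ≡ g → f ≤ g
  ≤-reflexive refl = ≤-refl

  ≤-trans : ∀ {X Y} {f g h : X ⇝ Y} → f ≤ g → g ≤ h → f ≤ h
  ≤-trans {f = f} {g} {h} f≤g g≤h = begin
    f ∨ h        ≡⟨ cong (f ∨_) g≤h ⟨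
    f ∨ (g ∨ h)  ≡⟨ ∨-assoc f g h ⟨
    (f ∨ g) ∨ h  ≡⟨ cong (_∨ h) f≤g ⟩
    g ∨ h        ≡⟨ g≤h ⟩
    h            ∎
    where open ≡-Reasoning

  ≤-antisym : ∀ {X Y} {f g : X ⇝ Y} → f ≤ g → g ≤ f → f ≡ g
  ≤-antisym {f = f} {g} f≤g g≤f = trans (sym g≤f) (trans (∨-comm g f) f≤g)

  ≤-isPartialOrder : ∀ {X Y} → IsPartialOrder (_≡_ {A = X ⇝ Y}) _≤_
  ≤-isPartialOrder = record
    { isPreorder = record
      { isEquivalence = isEquivalence
      ; reflexive     = ≤-reflexive
      ; trans         = ≤-trans
      }
    ; antisym = ≤-antisym
    }

  ≤-poset : Obj → Obj → Poset ℓ ℓ ℓ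
  ≤-poset X Y = record { isPartialOrder = ≤-isPartialOrder {X} {Y} }

  module ≤-Reasoning {X Y : Obj} = PartialOrderReasoning (≤-poset X Y)

  x≤x∨y : ∀ {X Y} (f g : X ⇝ Y) → f ≤ f ∨ g
  x≤x∨y f g = trans (sym (∨-assoc f f g)) (cong (_∨ g) (∨-idem f))

  y≤x∨y : ∀ {X Y} (f g : X ⇝ Y) → g ≤ f ∨ g
  y≤x∨y f g = subst (g ≤_) (∨-comm g f) (x≤x∨y g f)

  ≤⇒≡∨ : ∀ {X Y} {f g : X ⇝ Y} → g ≤ f → f ≡ f ∨ g
  ≤⇒≡∨ {f = f} {g} g≤f = sym (trans (∨-comm f g) g≤f)

  ·-monoˡ-≤ : ∀ {X Y Z} (g : X ⇝ Y) {f f′ : Y ⇝ Z} → f ≤ f′ → f · g ≤ f′ · g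
  ·-monoˡ-≤ g {f} {f′} f≤f′ = trans (sym (·-distribʳ f f′ g)) (cong (_· g) f≤f′)

  ·-monoʳ-≤ : ∀ {X Y Z} (f : Y ⇝ Z) {g g′ : X ⇝ Y} → g ≤ g′ → f · g ≤ f · g′
  ·-monoʳ-≤ f {g} {g′} g≤g′ = trans (sym (·-distribˡ f g g′)) (cong (f ·_) g≤g′)

  ·-mono-≤ : ∀ {X Y Z} {f f′ : Y ⇝ Z} {g g′ : X ⇝ Y} →
             f ≤ f′ → g ≤ g′ → f · g ≤ f′ · g′
  ·-mono-≤ {f = f} {g′ = g′} f≤f′ g≤g′ = ≤-trans (·-monoʳ-≤ f g≤g′) (·-monoˡ-≤ g′ f≤f′)

module KleeneStar {o ℓ : Level} {C : Category o ℓ} {M : Monad C} (K : Kleene M) where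
  open Kleisli M
  open KleisliLaws M
  open Kleene K
  open Additive additive
  open JoinOrder additive

  infix 10 _⋆ʳ _⋆ˡ

  _⋆ʳ : ∀ {X} → X ⇝ X → X ⇝ X
  α ⋆ʳ = lfpʳ 𝟙 α

  _⋆ˡ : ∀ {X} → X ⇝ X → X ⇝ X
  α ⋆ˡ = lfpˡ 𝟙 α

  lfpʳ≡·⋆ʳ : ∀ {X Y} (p : X ⇝ Y) (r : X ⇝ X) → lfpʳ p r ≡ p · r ⋆ʳ
  lfpʳ≡·⋆ʳ p r = trans (cong (λ u → lfpʳ u r) (sym (·-identityʳ p))) (lfpʳ-law p 𝟙 r)

  lfpˡ≡⋆ˡ· : ∀ {X Y} (p : X ⇝ Y) (r : Y ⇝ Y) → lfpˡ p r ≡ r ⋆ˡ · p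
  lfpˡ≡⋆ˡ· p r = trans (cong (λ u → lfpˡ u r) (sym (·-identityˡ p))) (lfpˡ-law 𝟙 p r)

  ⋆ʳ-induction : ∀ {X Y} {p g : X ⇝ Y} (r : X ⇝ X) → p ≤ g → g · r ≤ g → p · r ⋆ʳ ≤ g
  ⋆ʳ-induction {p = p} {g} r p≤g g·r≤g = ≤-trans (·-monoˡ-≤ (r ⋆ʳ) p≤g) g·r⋆≤g
    where
    g·r⋆≤g : g · r ⋆ʳ ≤ g
    g·r⋆≤g = subst (_≤ g) (lfpʳ≡·⋆ʳ g r) (lfpʳ-least g r g (≤⇒≡∨ g·r≤g))

  ⋆ˡ-induction : ∀ {X Y} {p g : X ⇝ Y} (r : Y ⇝ Y) → p ≤ g → r · g ≤ g → r ⋆ˡ · p ≤ g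
  ⋆ˡ-induction {p = p} {g} r p≤g r·g≤g = ≤-trans (·-monoʳ-≤ (r ⋆ˡ) p≤g) r⋆·g≤g
    where
    r⋆·g≤g : r ⋆ˡ · g ≤ g
    r⋆·g≤g = subst (_≤ g) (lfpˡ≡⋆ˡ· g r) (lfpˡ-least g r g (≤⇒≡∨ r·g≤g))

  𝟙≤⋆ʳ : ∀ {X} (α : X ⇝ X) → 𝟙 ≤ α ⋆ʳ
  𝟙≤⋆ʳ α = subst (𝟙 ≤_) (sym (lfpʳ-fix 𝟙 α)) (x≤x∨y _ _)

  𝟙≤⋆ˡ : ∀ {X} (α : X ⇝ X) → 𝟙 ≤ α ⋆ˡ
  𝟙≤⋆ˡ α = subst (𝟙 ≤_) (sym (lfpˡ-fix 𝟙 α)) (x≤x∨y _ _)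

  ⋆ʳ-unfold : ∀ {X} (α : X ⇝ X) → α ⋆ʳ · α ≤ α ⋆ʳ
  ⋆ʳ-unfold α = subst (α ⋆ʳ · α ≤_) (sym (lfpʳ-fix 𝟙 α)) (y≤x∨y _ _)

  ⋆ˡ-unfold : ∀ {X} (α : X ⇝ X) → α · α ⋆ˡ ≤ α ⋆ˡ
  ⋆ˡ-unfold α = subst (α · α ⋆ˡ ≤_) (sym (lfpˡ-fix 𝟙 α)) (y≤x∨y _ _)

  ≤⋆ʳ : ∀ {X} (α : X ⇝ X) → α ≤ α ⋆ʳ
  ≤⋆ʳ α = begin
    α          ≡⟨ ·-identityˡ α ⟨
    𝟙 · α      ≤⟨ ·-monoˡ-≤ α (𝟙≤⋆ʳ α) ⟩
    α ⋆ʳ · α   ≤⟨ ⋆ʳ-unfold α ⟩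
    α ⋆ʳ       ∎
    where open ≤-Reasoning

  ≤⋆ˡ : ∀ {X} (α : X ⇝ X) → α ≤ α ⋆ˡ
  ≤⋆ˡ α = begin
    α          ≡⟨ ·-identityʳ α ⟨
    α · 𝟙      ≤⟨ ·-monoʳ-≤ α (𝟙≤⋆ˡ α) ⟩
    α · α ⋆ˡ   ≤⟨ ⋆ˡ-unfold α ⟩
    α ⋆ˡ       ∎
    where open ≤-Reasoning

  ⋆ʳ-·-idem : ∀ {X} (α : X ⇝ X) → α ⋆ʳ · α ⋆ʳ ≤ α ⋆ʳ
  ⋆ʳ-·-idem α = ⋆ʳ-induction α ≤-refl (⋆ʳ-unfold α)

  ⋆ˡ-·-idem : ∀ {X} (α : X ⇝ X) → α ⋆ˡ · α ⋆ˡ ≤ α ⋆ˡ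
  ⋆ˡ-·-idem α = ⋆ˡ-induction α ≤-refl (⋆ˡ-unfold α)

  ⋆ʳ-least : ∀ {X} {α β : X ⇝ X} → 𝟙 ≤ β → α ≤ β → β · β ≤ β → α ⋆ʳ ≤ β
  ⋆ʳ-least {α = α} {β} 𝟙≤β α≤β β·β≤β =
    subst (_≤ β) (·-identityˡ (α ⋆ʳ))
      (⋆ʳ-induction α 𝟙≤β (≤-trans (·-monoʳ-≤ β α≤β) β·β≤β))

  ⋆ˡ-least : ∀ {X} {α β : X ⇝ X} → 𝟙 ≤ β → α ≤ β → β · β ≤ β → α ⋆ˡ ≤ β
  ⋆ˡ-least {α = α} {β} 𝟙≤β α≤β β·β≤β =
    subst (_≤ β) (·-identityʳ (α ⋆ˡ))
      (⋆ˡ-induction α 𝟙≤β (≤-trans (·-monoˡ-≤ β α≤β) β·β≤β))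

  ⋆ʳ≡⋆ˡ : ∀ {X} (α : X ⇝ X) → α ⋆ʳ ≡ α ⋆ˡ
  ⋆ʳ≡⋆ˡ α = ≤-antisym (⋆ʳ-least (𝟙≤⋆ˡ α) (≤⋆ˡ α) (⋆ˡ-·-idem α))
                      (⋆ˡ-least (𝟙≤⋆ʳ α) (≤⋆ʳ α) (⋆ʳ-·-idem α))

  ⋆ʳ-simulation : ∀ {X Y} {α : X ⇝ X} {β : Y ⇝ Y} (f : X ⇝ Y) →
                  f · α ≤ β · f → f · α ⋆ʳ ≤ β ⋆ʳ · f
  ⋆ʳ-simulation {α = α} {β} f f·α≤β·f = ⋆ʳ-induction α f≤β⋆·f β⋆·f·α≤β⋆·f
    where
    open ≤-Reasoning
    f≤β⋆·f : f ≤ β ⋆ʳ · f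
    f≤β⋆·f = begin
      f          ≡⟨ ·-identityˡ f ⟨
      𝟙 · f      ≤⟨ ·-monoˡ-≤ f (𝟙≤⋆ʳ β) ⟩
      β ⋆ʳ · f   ∎

    β⋆·f·α≤β⋆·f : (β ⋆ʳ · f) · α ≤ β ⋆ʳ · f
    β⋆·f·α≤β⋆·f = begin
      (β ⋆ʳ · f) · α   ≡⟨ ·-assoc (β ⋆ʳ) f α ⟩
      β ⋆ʳ · (f · α)   ≤⟨ ·-monoʳ-≤ (β ⋆ʳ) f·α≤β·f ⟩
      β ⋆ʳ · (β · f)   ≡⟨ ·-assoc (β ⋆ʳ) β f ⟨
      (β ⋆ʳ · β) · f   ≤⟨ ·-monoˡ-≤ f (⋆ʳ-unfold β) ⟩
      β ⋆ʳ · f         ∎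

  ⋆ˡ-simulation : ∀ {X Y} {α : X ⇝ X} {β : Y ⇝ Y} (f : X ⇝ Y) →
                  β · f ≤ f · α → β ⋆ˡ · f ≤ f · α ⋆ˡ
  ⋆ˡ-simulation {α = α} {β} f β·f≤f·α = ⋆ˡ-induction β f≤f·α⋆ β·f·α⋆≤f·α⋆
    where
    open ≤-Reasoning
    f≤f·α⋆ : f ≤ f · α ⋆ˡ
    f≤f·α⋆ = begin
      f          ≡⟨ ·-identityʳ f ⟨
      f · 𝟙      ≤⟨ ·-monoʳ-≤ f (𝟙≤⋆ˡ α) ⟩
      f · α ⋆ˡ   ∎

    β·f·α⋆≤f·α⋆ : β · (f · α ⋆ˡ) ≤ f · α ⋆ˡ
    β·f·α⋆≤f·α⋆ = begin
      β · (f · α ⋆ˡ)   ≡⟨ ·-assoc β f (α ⋆ˡ) ⟨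
      (β · f) · α ⋆ˡ   ≤⟨ ·-monoˡ-≤ (α ⋆ˡ) β·f≤f·α ⟩
      (f · α) · α ⋆ˡ   ≡⟨ ·-assoc f α (α ⋆ˡ) ⟩
      f · (α · α ⋆ˡ)   ≤⟨ ·-monoʳ-≤ f (⋆ˡ-unfold α) ⟩
      f · α ⋆ˡ         ∎

  ⋆ʳ-simulation≥ : ∀ {X Y} {α : X ⇝ X} {β : Y ⇝ Y} (f : X ⇝ Y) →
                   β · f ≤ f · α → β ⋆ʳ · f ≤ f · α ⋆ʳ
  ⋆ʳ-simulation≥ {α = α} {β} f β·f≤f·α
    rewrite ⋆ʳ≡⋆ˡ α | ⋆ʳ≡⋆ˡ β = ⋆ˡ-simulation f β·f≤f·α

  orderedSaturation : OrderedSaturation M _≤_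
  orderedSaturation = record
    { isPartialOrder = ≤-isPartialOrder
    ; ·-mono  = ·-mono-≤
    ; _*      = _⋆ʳ
    ; *-refl  = 𝟙≤⋆ʳ
    ; *-incl  = ≤⋆ʳ
    ; *-trans = ⋆ʳ-·-idem
    ; *-least = λ α β → ⋆ʳ-least
    ; *-sim≤  = λ f α β → ⋆ʳ-simulation (f ♯)
    ; *-sim≥  = λ f α β → ⋆ʳ-simulation≥ (f ♯)
    }

theorem5p4 : ∀ {o ℓ} (C : Category o ℓ) (M : Monad C) (K : Kleene M) → Theorem5p4 C M K
theorem5p4 C M K =
  orderedSaturation , (λ α f β → ⋆ʳ-simulation f) , (λ α f β → ⋆ʳ-simulation≥ f)
  where open KleeneStar K
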